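{- There exist constants $c>0$ and $\epsilon_0>0$ such that for every $\epsilon\in(0,\epsilon_0)$ there is an instance of the online weighted \textsc{MaximumIndependentSet} problem, whose graph contains only three vertices forming a path, on which every online algorithm that maintains at every time an independent set of weight at least $(1-\epsilon)\,\mathrm{opt}$ has amortized migration factor at least $c/\epsilon$.
   Context: Online weighted \textsc{MaximumIndependentSet} (dynamic): starting from the empty graph, at each time step one weighted vertex arrives together with its edges to present vertices, or one present vertex departs together with its edges. The algorithm outputs an independent set $S_t$ of the current graph at each time without knowledge of the future, and $\mathrm{opt}$ is the current maximum weight of an independent set. The migration potential of a step is the weight of the arriving or departing vertex. The migration cost of changing $S_{t-1}$ to $S_t$ is the total weight of $S_{t-1}\triangle S_t$, excluding the initial inclusion of a newly arrived vertex. The amortized migration factor is the maximum over $t$ of (total migration cost up to $t$)/(total migration potential up to $t$).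
   Formalization: The parameter ε ranges over the rationals, and the vertex weights of the instance and the constants c and ε₀ are taken in the rationals as well. -}

module Defs where

open import Data.Bool using (Bool; true; false; _∧_; _∨_; not; if_then_else_)
open import Data.Fin using (Fin; zero; suc)
open import Data.Maybe using (Maybe; just; nothing; fromMaybe; is-just)
open import Data.List using (List; []; _∷_; _++_; [_]; foldl; foldr; map; filter; length; take)
open import Data.Nat using (ℕ; zero; suc)
open import Data.Product using (Σ; _×_; _,_; proj₁; proj₂)
open import Data.Unit using (⊤)
open import Data.Rational using (ℚ; 0ℚ; 1ℚ; _+_; _*_; _-_; _⊔_; _<_; _≤_)
open import Relation.Binary.PropositionalEquality using (_≡_)

-- The three possible vertex positions on the fixed path 0 — 1 — 2.
-- Every vertex that is present occupies one of these positions, at most one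
-- vertex per position; two present vertices are adjacent iff their positions
-- are adjacent on the path.  Thus every current graph is an induced subgraph of
-- the 3-vertex path.
Pos : Set
Pos = Fin 3

adj : Pos → Pos → Bool
adj zero (suc zero) = true
adj (suc zero) zero = true
adj (suc zero) (suc (suc zero)) = true
adj (suc (suc zero)) (suc zero) = true
adj _ _ = false

allPos : List Pos
allPos = zero ∷ suc zero ∷ suc (suc zero) ∷ []

State : Set
State = Pos → Maybe ℚ

emptyState : State
emptyState _ = nothing

data Event : Set where
  arrive : Pos → ℚ → Event
  depart : Pos → Event

_≟P_ : ∀ {n} → Fin n → Fin n → Bool
zero ≟P zero = true
suc p ≟P suc q = p ≟P q
_ ≟P _ = false

apply : State → Event → State
apply s (arrive p w) q = if p ≟P q then just w else s q
apply s (depart p) q = if p ≟P q then nothing else s q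

stateAfter : List Event → State
stateAfter = foldl apply emptyState

ValidEvent : State → Event → Set
ValidEvent s (arrive p w) = (s p ≡ nothing) × (0ℚ < w)
ValidEvent s (depart p) = Σ ℚ λ w → s p ≡ just w

ValidFrom : State → List Event → Set
ValidFrom s [] = ⊤
ValidFrom s (e ∷ es) = ValidEvent s e × ValidFrom (apply s e) es

ValidInstance : List Event → Set
ValidInstance = ValidFrom emptyState

sumℚ : List ℚ → ℚ
sumℚ = foldr _+_ 0ℚ

VSet : Set
VSet = Pos → Bool

wt : State → Pos → ℚ
wt s p = fromMaybe 0ℚ (s p)

weightOf : State → VSet → ℚ
weightOf s S = sumℚ (map (λ p → if S p then wt s p else 0ℚ) allPos)

indepB : State → VSet → Bool
indepB s S =
  foldr _∧_ true (map (λ p → not (S p) ∨ is-just (s p)) allPos) ∧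
  foldr _∧_ true (map (λ p → foldr _∧_ true (map (λ q → not (S p ∧ S q ∧ adj p q)) allPos)) allPos)

IsIndependent : State → VSet → Set
IsIndependent s S = indepB s S ≡ true

mkSet : Bool → Bool → Bool → VSet
mkSet a b c zero = a
mkSet a b c (suc zero) = b
mkSet a b c (suc (suc zero)) = c

bools : List Bool
bools = true ∷ false ∷ []

allSets : List VSet
allSets = foldr (λ a acc → foldr (λ b acc₂ → foldr (λ c acc₃ → mkSet a b c ∷ acc₃) acc₂ bools) acc bools) [] bools

opt : State → ℚ
opt s = foldr _⊔_ 0ℚ (map (weightOf s) (filter (λ S → indepB s S Data.Bool.≟ true) allSets))

-- online algorithm: output depends only on the events seen so far
OnlineAlg : Set
OnlineAlg = List Event → VSet

potential : State → Event → ℚ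
potential s (arrive p w) = w
potential s (depart p) = wt s p

isArrivalAt : Event → Pos → Bool
isArrivalAt (arrive p w) q = p ≟P q
isArrivalAt (depart p) q = false

-- migration cost of going from Sprev (in state sprev) to Snew (after event e):
-- weight of Sprev △ Snew, excluding the newly arrived vertex
migCost : State → Event → VSet → VSet → ℚ
migCost sprev e Sprev Snew = sumℚ (map term allPos)
  where
  snew = apply sprev e
  term : Pos → ℚ
  term p = if Sprev p ∧ not (Snew p) then wt sprev p
           else if not (Sprev p) ∧ Snew p ∧ not (isArrivalAt e p) then wt snew p
           else 0ℚ

steps : OnlineAlg → List Event → List Event → List (ℚ × ℚ)
steps A h [] = []
steps A h (e ∷ es) =
  (migCost (stateAfter h) e (A h) (A (h ++ [ e ])) , potential (stateAfter h) e)
    ∷ steps A (h ++ [ e ]) es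

totalCost : OnlineAlg → List Event → ℕ → ℚ
totalCost A σ t = sumℚ (map proj₁ (take t (steps A [] σ)))

totalPotential : OnlineAlg → List Event → ℕ → ℚ
totalPotential A σ t = sumℚ (map proj₂ (take t (steps A [] σ)))

Maintains : ℚ → OnlineAlg → List Event → Set
Maintains ε A σ = ∀ t → t Data.Nat.≤ length σ →
  IsIndependent (stateAfter (take t σ)) (A (take t σ)) ×
  ((1ℚ - ε) * opt (stateAfter (take t σ)) ≤ weightOf (stateAfter (take t σ)) (A (take t σ)))

-- amortized migration factor (max over t ≥ 1 of cost/potential) is at least c/ε:
-- some t with c·potential(t) ≤ ε·cost(t)   (ε > 0)
FactorAtLeast : ℚ → ℚ → OnlineAlg → List Event → Set
FactorAtLeast c ε A σ = Σ ℕ λ t → (1 Data.Nat.≤ t) × (t Data.Nat.≤ length σ) ×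
  (c * totalPotential A σ t ≤ ε * totalCost A σ t)

-- On the path p₀ — p₁ — p₂ let vertices of weight 1 and C = 1 + 2ε sit at p₀
-- and p₁, and let a vertex of weight S = 4ε repeatedly arrive at p₂ and leave
-- again.  Without it, {p₁} is the only independent set of weight at least
-- (1 - ε)·opt; with it, {p₀, p₂} is the only one (this is where ε < ¼ is
-- used).  So every cycle forces two swaps between these sets, costing about 4,
-- while adding only 2S = 8ε to the migration potential; once k ≥ 1/ε cycles
-- have absorbed the initial potential C + 1, cost/potential ≥ 1/(4ε).
module Submission where

open import Defs
open import Data.Bool using (Bool; true; false)
open import Data.Empty using (⊥-elim)
open import Data.Fin using (zero; suc)
open import Data.Integer as ℤ using (+_; +[1+_]; -[1+_])
import Data.Integer.Properties as ℤ
open import Data.List using (List; []; _∷_; _++_; [_]; foldr; map; length; take)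
open import Data.List.Membership.Propositional using (_∈_)
open import Data.List.Membership.Propositional.Properties using (∈-filter⁺; ∈-map⁺)
open import Data.List.Properties using (foldl-++; ++-assoc; length-++-≤ˡ)
open import Data.List.Relation.Unary.Any using (here; there)
open import Data.Maybe using (Maybe; just; nothing)
open import Data.Nat as ℕ using (ℕ; zero; suc)
import Data.Nat.Properties as ℕ
open import Data.Product using (Σ; ∃; _×_; _,_; proj₁; proj₂)
open import Data.Rational hiding (truncate)
open import Data.Rational.Properties
open import Algebra.Definitions.RawMonoid +-0-rawMonoid using () renaming (_×_ to _·_)
open import Data.Rational.Solver using (module +-*-Solver)
import Data.Rational.Unnormalised as ℚᵘ
open ℚᵘ using (mkℚᵘ; *≡*; *≤*) renaming (_≃_ to _≃ᵘ_)
import Data.Rational.Unnormalised.Properties as ℚᵘ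
open import Data.Unit using (tt)
open import Relation.Binary.PropositionalEquality hiding ([_])
open import Relation.Nullary using (¬_)

toℚᵘ-·-1ℚ : ∀ k → toℚᵘ (k · 1ℚ) ≃ᵘ mkℚᵘ (+ k) 0
toℚᵘ-·-1ℚ zero = ℚᵘ.≃-refl
toℚᵘ-·-1ℚ (suc k) = begin
  toℚᵘ (1ℚ + k · 1ℚ)          ≈⟨ toℚᵘ-homo-+ 1ℚ (k · 1ℚ) ⟩
  ℚᵘ.1ℚᵘ ℚᵘ.+ toℚᵘ (k · 1ℚ)   ≈⟨ ℚᵘ.+-congʳ ℚᵘ.1ℚᵘ (toℚᵘ-·-1ℚ k) ⟩
  ℚᵘ.1ℚᵘ ℚᵘ.+ mkℚᵘ (+ k) 0     ≈⟨ *≡* (trans (ℤ.*-identityʳ _)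
                                    (trans (cong (λ i → ℤ.1ℤ ℤ.+ i) (ℤ.*-identityʳ (+ k))) (sym (ℤ.*-identityʳ _)))) ⟩
  mkℚᵘ (+ suc k) 0            ∎
  where open ℚᵘ.≃-Reasoning

n≤[1+m]*n : ∀ m n → ℤ.1ℤ ℤ.* (+ n ℤ.* ℤ.1ℤ) ℤ.≤ (+[1+ m ] ℤ.* + n) ℤ.* ℤ.1ℤ
n≤[1+m]*n m n = begin
  ℤ.1ℤ ℤ.* (+ n ℤ.* ℤ.1ℤ)     ≡⟨ ℤ.*-identityˡ _ ⟩
  + n ℤ.* ℤ.1ℤ               ≡⟨ ℤ.*-identityʳ _ ⟩
  + n                        ≡⟨ ℤ.*-identityˡ _ ⟨
  ℤ.1ℤ ℤ.* + n               ≤⟨ ℤ.*-monoʳ-≤-nonNeg (+ n) (ℤ.+≤+ (ℕ.s≤s (ℕ.z≤n {m}))) ⟩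
  +[1+ m ] ℤ.* + n           ≡⟨ ℤ.*-identityʳ _ ⟨
  (+[1+ m ] ℤ.* + n) ℤ.* ℤ.1ℤ ∎
  where open ℤ.≤-Reasoning

archimedean : ∀ p → 0ℚ < p → ∃ λ k → 1ℚ ≤ p * (k · 1ℚ)
archimedean p@(mkℚ +[1+ n ] d-1 _) _ = suc d-1 , toℚᵘ-cancel-≤ (begin
  ℚᵘ.1ℚᵘ                             ≤⟨ *≤* (n≤[1+m]*n n (suc d-1)) ⟩
  toℚᵘ p ℚᵘ.* mkℚᵘ (+ suc d-1) 0     ≃⟨ ℚᵘ.*-congˡ {toℚᵘ p} (ℚᵘ.≃-sym (toℚᵘ-·-1ℚ (suc d-1))) ⟩
  toℚᵘ p ℚᵘ.* toℚᵘ (suc d-1 · 1ℚ)    ≃⟨ ℚᵘ.≃-sym (toℚᵘ-homo-* p (suc d-1 · 1ℚ)) ⟩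
  toℚᵘ (p * (suc d-1 · 1ℚ))          ∎)
  where open ℚᵘ.≤-Reasoning
archimedean (mkℚ (+ 0) _ _) (*<* (ℤ.+<+ ()))
archimedean (mkℚ -[1+ _ ] _ _) (*<* ())

≤-gap : ∀ {x y} d → 0ℚ ≤ d → y ≡ x + d → x ≤ y
≤-gap {x} d 0≤d refl = subst (_≤ x + d) (+-identityʳ x) (+-monoʳ-≤ x 0≤d)

<-gap : ∀ {x y} d → 0ℚ < d → y ≡ x + d → x < y
<-gap {x} d 0<d refl = subst (_< x + d) (+-identityʳ x) (+-monoʳ-< x 0<d)

*-nonNeg : ∀ {p q} → 0ℚ ≤ p → 0ℚ ≤ q → 0ℚ ≤ p * q
*-nonNeg {p} {q} 0≤p 0≤q = nonNegative⁻¹ (p * q) {{nonNeg*nonNeg⇒nonNeg p {{nonNegative 0≤p}} q {{nonNegative 0≤q}}}}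

*-pos : ∀ {p q} → 0ℚ < p → 0ℚ < q → 0ℚ < p * q
*-pos {p} {q} 0<p 0<q = positive⁻¹ (p * q) {{pos*pos⇒pos p {{positive 0<p}} q {{positive 0<q}}}}

≤-foldr-⊔ : ∀ {x} xs → x ∈ xs → x ≤ foldr _⊔_ 0ℚ xs
≤-foldr-⊔ (y ∷ ys) (here refl) = p≤p⊔q y _
≤-foldr-⊔ (y ∷ ys) (there x∈ys) = ≤-trans (≤-foldr-⊔ ys x∈ys) (p≤q⊔p y _)

take-length-++ : ∀ {A : Set} (xs ys : List A) → take (length xs) (xs ++ ys) ≡ xs
take-length-++ []       ys = refl
take-length-++ (x ∷ xs) ys = cong (x ∷_) (take-length-++ xs ys)

p₀ p₁ p₂ : Pos
p₀ = zero
p₁ = suc zero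
p₂ = suc (suc zero)

Triple : Set → Set
Triple A = A × A × A

-- The definitions in Defs inspect states and vertex sets only at the three
-- positions, so they agree definitionally on s and on state (contents s).
contents : State → Triple (Maybe ℚ)
contents s = s p₀ , s p₁ , s p₂

members : VSet → Triple Bool
members T = T p₀ , T p₁ , T p₂

state : Triple (Maybe ℚ) → State
state (x , y , z) zero             = x
state (x , y , z) (suc zero)       = y
state (x , y , z) (suc (suc zero)) = z

set : Triple Bool → VSet
set (x , y , z) = mkSet x y z

set∈allSets : ∀ b → set b ∈ allSets
set∈allSets (true  , true  , true)  = here refl
set∈allSets (true  , true  , false) = there (here refl)
set∈allSets (true  , false , true)  = there (there (here refl))
set∈allSets (true  , false , false) = there (there (there (here refl)))
set∈allSets (false , true  , true)  = there (there (there (there (here refl))))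
set∈allSets (false , true  , false) = there (there (there (there (there (here refl)))))
set∈allSets (false , false , true)  = there (there (there (there (there (there (here refl))))))
set∈allSets (false , false , false) = there (there (there (there (there (there (there (here refl)))))))

weightOf≤opt : ∀ s T → IsIndependent s T → weightOf s T ≤ opt s
weightOf≤opt s T indep = ≤-foldr-⊔ _
  (∈-map⁺ (weightOf s) (∈-filter⁺ (λ U → indepB s U Data.Bool.≟ true) (set∈allSets (members T)) indep))

NearOptimal : ℚ → State → VSet → Set
NearOptimal ε s T = IsIndependent s T × ((1ℚ - ε) * opt s ≤ weightOf s T)

migCost-canonical : ∀ s e T T′ {t b b′} → contents s ≡ t → members T ≡ b → members T′ ≡ b′ →
  migCost s e T T′ ≡ migCost (state t) e (set b) (set b′)
migCost-canonical s (arrive p w) T T′ refl refl refl = refl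
migCost-canonical s (depart p)   T T′ refl refl refl = refl

potential-canonical : ∀ s e {t} → contents s ≡ t → potential s e ≡ potential (state t) e
potential-canonical s (arrive p w)              refl = refl
potential-canonical s (depart zero)             refl = refl
potential-canonical s (depart (suc zero))       refl = refl
potential-canonical s (depart (suc (suc zero))) refl = refl

contents-apply : ∀ s e → contents (apply s e) ≡ contents (apply (state (contents s)) e)
contents-apply s (arrive p w) = refl
contents-apply s (depart p)   = refl

contents-snoc : ∀ {t} h e → contents (stateAfter h) ≡ t → contents (stateAfter (h ++ [ e ])) ≡ contents (apply (state t) e)
contents-snoc h e refl = trans (cong contents (foldl-++ apply emptyState h [ e ])) (contents-apply (stateAfter h) e)

maintains⇒nearOptimal : ∀ {ε A σ} → Maintains ε A σ → ∀ h es → h ++ es ≡ σ → NearOptimal ε (stateAfter h) (A h)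
maintains⇒nearOptimal {ε} {A} maintains h es refl =
  subst (λ l → NearOptimal ε (stateAfter l) (A l)) (take-length-++ h es) (maintains (length h) (length-++-≤ˡ h))

forced : ∀ {ε t b} → (∀ b′ → NearOptimal ε (state t) (set b′) → b′ ≡ b) →
  ∀ s T → contents s ≡ t → NearOptimal ε s T → members T ≡ b
forced forces s T refl near = forces (members T) near

costs potentials : OnlineAlg → List Event → List Event → ℚ
costs A h es = sumℚ (map proj₁ (steps A h es))
potentials A h es = sumℚ (map proj₂ (steps A h es))

take-length-steps : ∀ A h es → take (length es) (steps A h es) ≡ steps A h es
take-length-steps A h []       = refl
take-length-steps A h (e ∷ es) = cong (_ ∷_) (take-length-steps A (h ++ [ e ]) es)

¼ : ℚ
¼ = + 1 / 4

module Gadget (ε : ℚ) (0<ε : 0ℚ < ε) (ε<¼ : ε < ¼) where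
  open +-*-Solver

  a C S δ : ℚ
  a = 1ℚ - ε
  C = 1ℚ + (ε + ε)
  S = (ε + ε) + (ε + ε)
  δ = ¼ - ε

  0≤ε : 0ℚ ≤ ε
  0≤ε = <⇒≤ 0<ε

  0<δ : 0ℚ < δ
  0<δ = subst (_< δ) (+-inverseʳ ε) (+-monoˡ-< (- ε) ε<¼)

  0≤δ : 0ℚ ≤ δ
  0≤δ = <⇒≤ 0<δ

  0≤a : 0ℚ ≤ a
  0≤a = ≤-gap (½ + ¼ + δ) (+-mono-≤ (nonNegative⁻¹ (½ + ¼)) 0≤δ)
    (solve 1 (λ e → con 1ℚ :- e := con 0ℚ :+ (con ½ :+ con ¼ :+ (con ¼ :- e))) refl ε)

  1≤C : 1ℚ ≤ C
  1≤C = ≤-gap (ε + ε) (+-mono-≤ 0≤ε 0≤ε) refl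

  0<C : 0ℚ < C
  0<C = <-≤-trans (positive⁻¹ 1ℚ) 1≤C

  0<S : 0ℚ < S
  0<S = +-mono-<-≤ (+-mono-<-≤ 0<ε 0≤ε) (+-mono-≤ 0≤ε 0≤ε)

  S≤C : S ≤ C
  S≤C = ≤-gap (½ + (δ + δ)) (+-mono-≤ (nonNegative⁻¹ ½) (+-mono-≤ 0≤δ 0≤δ))
    (solve 1 (λ e → con 1ℚ :+ (e :+ e) := ((e :+ e) :+ (e :+ e)) :+ (con ½ :+ ((con ¼ :- e) :+ (con ¼ :- e)))) refl ε)

  1<aC : 1ℚ < a * C
  1<aC = <-gap (ε * (½ + (δ + δ))) (*-pos 0<ε (+-mono-<-≤ (positive⁻¹ ½) (+-mono-≤ 0≤δ 0≤δ)))
    (solve 1 (λ e → (con 1ℚ :- e) :* (con 1ℚ :+ (e :+ e)) := con 1ℚ :+ e :* (con ½ :+ ((con ¼ :- e) :+ (con ¼ :- e)))) refl ε)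

  C<a[1+S] : C < a * (1ℚ + S)
  C<a[1+S] = <-gap (ε * (δ + δ + δ + δ)) (*-pos 0<ε (+-mono-<-≤ (+-mono-<-≤ (+-mono-<-≤ 0<δ 0≤δ) 0≤δ) 0≤δ))
    (solve 1 (λ e → (con 1ℚ :- e) :* (con 1ℚ :+ ((e :+ e) :+ (e :+ e)))
                    := (con 1ℚ :+ (e :+ e)) :+ e :* ((con ¼ :- e) :+ (con ¼ :- e) :+ (con ¼ :- e) :+ (con ¼ :- e))) refl ε)

  0<aC : 0ℚ < a * C
  0<aC = <-trans (positive⁻¹ 1ℚ) 1<aC

  outweighed : ∀ s T U {w W} → IsIndependent s U → weightOf s U ≡ W →
    weightOf s T ≤ w → w < a * W → ¬ NearOptimal ε s T
  outweighed s T U indep refl T≤w w<aW (_ , near) = <-irrefl refl (begin-strict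
    weightOf s T      ≤⟨ T≤w ⟩
    _                 <⟨ w<aW ⟩
    a * weightOf s U  ≤⟨ *-monoˡ-≤-nonNeg a {{nonNegative 0≤a}} (weightOf≤opt s U indep) ⟩
    a * opt s         ≤⟨ near ⟩
    weightOf s T      ∎)
    where open ≤-Reasoning

  empty middle pair path : Triple (Maybe ℚ)
  empty  = nothing , nothing , nothing
  middle = nothing , just C , nothing
  pair   = just 1ℚ , just C , nothing
  path   = just 1ℚ , just C , just S

  weight-middle : ∀ x z → weightOf (state (x , just C , z)) (set (false , true , false)) ≡ C
  weight-middle x z = trans (+-identityˡ _) (+-identityʳ C)

  weight-ends : weightOf (state path) (set (true , false , true)) ≡ 1ℚ + S
  weight-ends = cong (_+_ 1ℚ) (trans (+-identityˡ _) (+-identityʳ S))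

  weight-right : weightOf (state path) (set (false , false , true)) ≡ S
  weight-right = trans (+-identityˡ _) (trans (+-identityˡ _) (+-identityʳ S))

  empty-forces : ∀ b → NearOptimal ε (state empty) (set b) → b ≡ (false , false , false)
  empty-forces (false , false , false) _ = refl
  empty-forces (true  , true  , true)  (() , _)
  empty-forces (true  , true  , false) (() , _)
  empty-forces (true  , false , true)  (() , _)
  empty-forces (true  , false , false) (() , _)
  empty-forces (false , true  , true)  (() , _)
  empty-forces (false , true  , false) (() , _)
  empty-forces (false , false , true)  (() , _)

  middle-forces : ∀ b → NearOptimal ε (state middle) (set b) → b ≡ (false , true , false)
  middle-forces (false , true  , false) _ = refl
  middle-forces b@(false , false , false) near = ⊥-elim
    (outweighed (state middle) (set b) (set (false , true , false)) refl (weight-middle nothing nothing) ≤-refl 0<aC near)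
  middle-forces (true  , true  , true)  (() , _)
  middle-forces (true  , true  , false) (() , _)
  middle-forces (true  , false , true)  (() , _)
  middle-forces (true  , false , false) (() , _)
  middle-forces (false , true  , true)  (() , _)
  middle-forces (false , false , true)  (() , _)

  pair-forces : ∀ b → NearOptimal ε (state pair) (set b) → b ≡ (false , true , false)
  pair-forces (false , true  , false) _ = refl
  pair-forces b@(true , false , false) near = ⊥-elim
    (outweighed (state pair) (set b) (set (false , true , false)) refl (weight-middle (just 1ℚ) nothing) ≤-refl 1<aC near)
  pair-forces b@(false , false , false) near = ⊥-elim
    (outweighed (state pair) (set b) (set (false , true , false)) refl (weight-middle (just 1ℚ) nothing) ≤-refl 0<aC near)
  pair-forces (true  , true  , true)  (() , _)
  pair-forces (true  , true  , false) (() , _)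
  pair-forces (true  , false , true)  (() , _)
  pair-forces (false , true  , true)  (() , _)
  pair-forces (false , false , true)  (() , _)

  path-forces : ∀ b → NearOptimal ε (state path) (set b) → b ≡ (true , false , true)
  path-forces (true , false , true) _ = refl
  path-forces b@(true , false , false) near = ⊥-elim
    (outweighed (state path) (set b) (set (true , false , true)) refl weight-ends 1≤C C<a[1+S] near)
  path-forces b@(false , true , false) near = ⊥-elim
    (outweighed (state path) (set b) (set (true , false , true)) refl weight-ends
      (≤-reflexive (weight-middle (just 1ℚ) (just S))) C<a[1+S] near)
  path-forces b@(false , false , true) near = ⊥-elim
    (outweighed (state path) (set b) (set (true , false , true)) refl weight-ends
      (≤-trans (≤-reflexive weight-right) S≤C) C<a[1+S] near)
  path-forces b@(false , false , false) near = ⊥-elim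
    (outweighed (state path) (set b) (set (true , false , true)) refl weight-ends
      (≤-trans (nonNegative⁻¹ 1ℚ) 1≤C) C<a[1+S] near)
  path-forces (true  , true  , true)  (() , _)
  path-forces (true  , true  , false) (() , _)
  path-forces (false , true  , true)  (() , _)

  arriveC arrive1 arriveS departS : Event
  arriveC = arrive p₁ C
  arrive1 = arrive p₀ 1ℚ
  arriveS = arrive p₂ S
  departS = depart p₂

  cycles : ℕ → List Event
  cycles zero    = []
  cycles (suc j) = arriveS ∷ departS ∷ cycles j

  adversary : ℕ → List Event
  adversary k = arriveC ∷ arrive1 ∷ cycles k

  cycles-valid : ∀ j s → s p₂ ≡ nothing → ValidFrom s (cycles j)
  cycles-valid zero    s _       = tt
  cycles-valid (suc j) s p₂-free = (p₂-free , 0<S) , (S , refl) , cycles-valid j _ refl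

  adversary-valid : ∀ k → ValidInstance (adversary k)
  adversary-valid k = (refl , 0<C) , (refl , positive⁻¹ 1ℚ) , cycles-valid k _ refl

  after-arrival : ∀ h → contents (stateAfter h) ≡ pair → contents (stateAfter (h ++ [ arriveS ])) ≡ path
  after-arrival h = contents-snoc h arriveS

  after-departure : ∀ h → contents (stateAfter h) ≡ path → contents (stateAfter (h ++ [ departS ])) ≡ pair
  after-departure h = contents-snoc h departS

  arrivalCost departureCost cycleCost : ℚ
  arrivalCost   = migCost (state pair) arriveS (set (false , true , false)) (set (true , false , true))
  departureCost = migCost (state path) departS (set (true , false , true)) (set (false , true , false))
  cycleCost     = arrivalCost + departureCost

  cycles-potential : ∀ A j h → contents (stateAfter h) ≡ pair → potentials A h (cycles j) ≡ (j · 1ℚ) * (S + S)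
  cycles-potential A zero    h _   = sym (*-zeroˡ (S + S))
  cycles-potential A (suc j) h inv = begin
    S + (potential (stateAfter h₁) departS + potentials A h₂ (cycles j))
      ≡⟨ cong₂ (λ p q → S + (p + q)) (potential-canonical (stateAfter h₁) departS inv₁) (cycles-potential A j h₂ inv₂) ⟩
    S + (S + (j · 1ℚ) * (S + S))
      ≡⟨ solve 2 (λ K s → s :+ (s :+ K :* (s :+ s)) := (con 1ℚ :+ K) :* (s :+ s)) refl (j · 1ℚ) S ⟩
    (suc j · 1ℚ) * (S + S) ∎
    where
    open ≡-Reasoning
    h₁ = h ++ [ arriveS ]
    h₂ = h₁ ++ [ departS ]
    inv₁ = after-arrival h inv
    inv₂ = after-departure h₁ inv₁

  module _ (k : ℕ) (A : OnlineAlg) (near : ∀ h es → h ++ es ≡ adversary k → NearOptimal ε (stateAfter h) (A h)) where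

    cycles-cost : ∀ j h → contents (stateAfter h) ≡ pair → h ++ cycles j ≡ adversary k →
      costs A h (cycles j) ≡ (j · 1ℚ) * cycleCost
    cycles-cost zero    h _   _   = sym (*-zeroˡ cycleCost)
    cycles-cost (suc j) h inv pre = begin
      migCost (stateAfter h) arriveS (A h) (A h₁) + (migCost (stateAfter h₁) departS (A h₁) (A h₂) + costs A h₂ (cycles j))
        ≡⟨ cong₂ (λ p q → p + (q + costs A h₂ (cycles j)))
                 (migCost-canonical (stateAfter h) arriveS (A h) (A h₁) inv A-h A-h₁)
                 (migCost-canonical (stateAfter h₁) departS (A h₁) (A h₂) inv₁ A-h₁ A-h₂) ⟩
      arrivalCost + (departureCost + costs A h₂ (cycles j))
        ≡⟨ cong (λ c → arrivalCost + (departureCost + c)) (cycles-cost j h₂ inv₂ pre₂) ⟩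
      arrivalCost + (departureCost + (j · 1ℚ) * cycleCost)
        ≡⟨ solve 3 (λ K x y → x :+ (y :+ K :* (x :+ y)) := (con 1ℚ :+ K) :* (x :+ y))
                   refl (j · 1ℚ) arrivalCost departureCost ⟩
      (suc j · 1ℚ) * cycleCost ∎
      where
      open ≡-Reasoning
      h₁ = h ++ [ arriveS ]
      h₂ = h₁ ++ [ departS ]
      inv₁ = after-arrival h inv
      inv₂ = after-departure h₁ inv₁
      pre₁ : h₁ ++ departS ∷ cycles j ≡ adversary k
      pre₁ = trans (++-assoc h [ arriveS ] _) pre
      pre₂ : h₂ ++ cycles j ≡ adversary k
      pre₂ = trans (++-assoc h₁ [ departS ] _) pre₁
      A-h : members (A h) ≡ (false , true , false)
      A-h = forced {ε} pair-forces (stateAfter h) (A h) inv (near h _ pre)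
      A-h₁ : members (A h₁) ≡ (true , false , true)
      A-h₁ = forced {ε} path-forces (stateAfter h₁) (A h₁) inv₁ (near h₁ _ pre₁)
      A-h₂ : members (A h₂) ≡ (false , true , false)
      A-h₂ = forced {ε} pair-forces (stateAfter h₂) (A h₂) inv₂ (near h₂ _ pre₂)

    adversary-cost : costs A [] (adversary k) ≡ (k · 1ℚ) * cycleCost
    adversary-cost = begin
      migCost (stateAfter []) arriveC (A []) (A h₁) + (migCost (stateAfter h₁) arrive1 (A h₁) (A h₂) + costs A h₂ (cycles k))
        ≡⟨ cong₂ (λ p q → p + (q + costs A h₂ (cycles k)))
                 (migCost-canonical (stateAfter []) arriveC (A []) (A h₁) refl A-[] A-h₁)
                 (migCost-canonical (stateAfter h₁) arrive1 (A h₁) (A h₂) refl A-h₁ A-h₂) ⟩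
      0ℚ + (0ℚ + costs A h₂ (cycles k))  ≡⟨ +-identityˡ _ ⟩
      0ℚ + costs A h₂ (cycles k)         ≡⟨ +-identityˡ _ ⟩
      costs A h₂ (cycles k)              ≡⟨ cycles-cost k h₂ refl refl ⟩
      (k · 1ℚ) * cycleCost               ∎
      where
      open ≡-Reasoning
      h₁ = [ arriveC ]
      h₂ = arriveC ∷ arrive1 ∷ []
      A-[] : members (A []) ≡ (false , false , false)
      A-[] = forced {ε} empty-forces (stateAfter []) (A []) refl (near [] _ refl)
      A-h₁ : members (A h₁) ≡ (false , true , false)
      A-h₁ = forced {ε} middle-forces (stateAfter h₁) (A h₁) refl (near h₁ _ refl)
      A-h₂ : members (A h₂) ≡ (false , true , false)
      A-h₂ = forced {ε} pair-forces (stateAfter h₂) (A h₂) refl (near h₂ _ refl)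

  adversary-potential : ∀ k A → potentials A [] (adversary k) ≡ C + (1ℚ + (k · 1ℚ) * (S + S))
  adversary-potential k A = cong (λ p → C + (1ℚ + p)) (cycles-potential A k (arriveC ∷ arrive1 ∷ []) refl)

  budget : ∀ K → 1ℚ ≤ ε * K → ¼ * (C + (1ℚ + K * (S + S))) ≤ ε * (K * cycleCost)
  budget K 1≤εK = begin
    ¼ * (C + (1ℚ + K * (S + S)))       ≡⟨ solve 3 (λ c s K → con ¼ :* (c :+ (con 1ℚ :+ K :* (s :+ s)))
                                                      := con ¼ :* (c :+ con 1ℚ) :+ con ¼ :* (K :* (s :+ s))) refl C S K ⟩
    ¼ * (C + 1ℚ) + ¼ * (K * (S + S))   ≤⟨ +-monoˡ-≤ (¼ * (K * (S + S))) (≤-trans initial≤1 1≤εK) ⟩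
    ε * K + ¼ * (K * (S + S))          ≤⟨ cycles-pay ⟩
    ε * (K * cycleCost)                ∎
    where
    open ≤-Reasoning
    initial≤1 : ¼ * (C + 1ℚ) ≤ 1ℚ
    initial≤1 = ≤-gap (½ * a) (*-nonNeg (nonNegative⁻¹ ½) 0≤a)
      (solve 1 (λ e → con 1ℚ := con ¼ :* ((con 1ℚ :+ (e :+ e)) :+ con 1ℚ) :+ con ½ :* (con 1ℚ :- e)) refl ε)
    0≤εK : 0ℚ ≤ ε * K
    0≤εK = ≤-trans (nonNegative⁻¹ 1ℚ) 1≤εK
    0≤1+2S : 0ℚ ≤ 1ℚ + (S + S)
    0≤1+2S = <⇒≤ (+-mono-<-≤ (positive⁻¹ 1ℚ) (<⇒≤ (+-mono-< 0<S 0<S)))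
    -- cycleCost = (1 + C + 0) + (1 + C + S + 0): the arriving vertex itself is not charged.
    cycles-pay : ε * K + ¼ * (K * (S + S)) ≤ ε * (K * cycleCost)
    cycles-pay = ≤-gap ((ε * K) * (1ℚ + (S + S))) (*-nonNeg 0≤εK 0≤1+2S)
      (solve 2 (λ e K → let c = con 1ℚ :+ (e :+ e); s = (e :+ e) :+ (e :+ e) in
                 e :* (K :* ((con 1ℚ :+ (c :+ con 0ℚ)) :+ (con 1ℚ :+ (c :+ (s :+ con 0ℚ)))))
                 := (e :* K :+ con ¼ :* (K :* (s :+ s))) :+ (e :* K) :* (con 1ℚ :+ (s :+ s))) refl ε K)

  adversary-forces-migration : ∀ k → 1ℚ ≤ ε * (k · 1ℚ) →
    ∀ A → Maintains ε A (adversary k) → FactorAtLeast ¼ ε A (adversary k)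
  adversary-forces-migration k 1≤εk A maintains = length σ , ℕ.s≤s ℕ.z≤n , ℕ.≤-refl , (begin
    ¼ * totalPotential A σ (length σ)   ≡⟨ cong (λ l → ¼ * sumℚ (map proj₂ l)) (take-length-steps A [] σ) ⟩
    ¼ * potentials A [] σ               ≡⟨ cong (¼ *_) (adversary-potential k A) ⟩
    ¼ * (C + (1ℚ + K * (S + S)))        ≤⟨ budget K 1≤εk ⟩
    ε * (K * cycleCost)                 ≡⟨ cong (ε *_) (adversary-cost k A (maintains⇒nearOptimal {ε} {A} maintains)) ⟨
    ε * costs A [] σ                    ≡⟨ cong (λ l → ε * sumℚ (map proj₁ l)) (take-length-steps A [] σ) ⟨
    ε * totalCost A σ (length σ)        ∎)
    where
    open ≤-Reasoning
    σ = adversary k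
    K = k · 1ℚ

theorem21 : Σ ℚ λ c → Σ ℚ λ ε₀ → (0ℚ < c) × (0ℚ < ε₀) ×
    ((ε : ℚ) → 0ℚ < ε → ε < ε₀ →
      Σ (List Event) λ σ → ValidInstance σ ×
        ((A : OnlineAlg) → Maintains ε A σ → FactorAtLeast c ε A σ))
theorem21 = ¼ , ¼ , positive⁻¹ ¼ , positive⁻¹ ¼ , λ ε 0<ε ε<¼ →
  let open Gadget ε 0<ε ε<¼
      (k , 1≤εk) = archimedean ε 0<ε
  in adversary k , adversary-valid k , adversary-forces-migration k 1≤εk
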